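{- Let $q$ be an odd prime power, $\alpha$ a primitive element of $\mathbb{F}_{q^4}$, and $\mathrm{Tr}(a)=a+a^q+a^{q^2}+a^{q^3}$. The equation $\mathrm{Tr}(\alpha^{(q+1)x})=0$ has the unique solution $x=\frac{q^2+1}{2}$ with $0\le x<q^2+1$. Consequently, for $0\le x<q^2+1$, $x(q+1)\in D$ if and only if $x=\frac{q^2+1}{2}$.
   Context: $D=\{i\in\mathbb{Z}_{(q^4-1)/(q-1)}:\mathrm{Tr}(\alpha^i)=0\}$. -}

module Defs where

open import Level using (Level)
open import Data.Nat using (ℕ; zero; suc)
import Data.Nat as ℕ
open import Data.Nat.Primality using (Prime)
open import Data.Fin using (Fin)
open import Data.Product using (Σ; ∃; _×_; _,_)
open import Relation.Nullary using (¬_)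
open import Relation.Binary.PropositionalEquality using (_≡_)
open import Algebra.Bundles using (CommutativeRing)

IsOddPrimePower : ℕ → Set
IsOddPrimePower q =
  (Σ ℕ λ p → Σ ℕ λ k → Prime p × (1 ℕ.≤ k) × (q ≡ p ℕ.^ k)) × (q ℕ.% 2 ≡ 1)

module _ {c ℓ : Level} (F : CommutativeRing c ℓ) where
  open CommutativeRing F

  pow : Carrier → ℕ → Carrier
  pow a zero    = 1#
  pow a (suc n) = a * pow a n

  IsField : Set (c Level.⊔ ℓ)
  IsField = (¬ (1# ≈ 0#)) × (∀ x → ¬ (x ≈ 0#) → Σ Carrier λ y → x * y ≈ 1#)

  HasCardinality : ℕ → Set (c Level.⊔ ℓ)
  HasCardinality n = Σ (Fin n → Carrier) λ e →
    (∀ i j → e i ≈ e j → i ≡ j) × (∀ y → Σ (Fin n) λ i → e i ≈ y)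

  IsPrimitive : Carrier → Set (c Level.⊔ ℓ)
  IsPrimitive α = (¬ (α ≈ 0#)) × (∀ y → ¬ (y ≈ 0#) → Σ ℕ λ k → pow α k ≈ y)

  Tr : ℕ → Carrier → Carrier
  Tr q a = a + pow a q + pow a (q ℕ.^ 2) + pow a (q ℕ.^ 3)

-- N = (q^4 - 1)/(q - 1) = q^3 + q^2 + q + 1
N : ℕ → ℕ
N q = suc (q ℕ.^ 3 ℕ.+ q ℕ.^ 2 ℕ.+ q)

module _ {c ℓ : Level} (F : CommutativeRing c ℓ) where
  open CommutativeRing F

  -- membership of (the residue of) i in D = { i ∈ Z_N : Tr(α^i) = 0 }
  InD : ℕ → Carrier → ℕ → Set ℓ
  InD q α i = Tr F q (pow F α (i ℕ.% N q)) ≈ 0#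

{-# OPTIONS --safe #-}
-- Put z = α^x and w = z^(q²-1). Since z^(q⁴) = z, the four conjugates of z^(q+1) pair up as
-- Tr(z^(q+1)) = (z + z^(q²)) (z^q + z^(q³)) = z^(q+1) (1 + w) (1 + w^q).
-- As w^(q²+1) = z^(q⁴-1) = 1 and q is odd, w^q = -1 gives w^(q²) = -1 and then w = -1, so the trace
-- vanishes iff w = -1. Because α has order exactly q⁴-1, the element -1 is α^((q²-1)(q²+1)/2), and
-- w = α^((q²-1)x) with 0 ≤ x < q²+1 equals it iff x = (q²+1)/2.
module Submission where

open import Defs
open import Level using (Level)
open import Data.Nat using (ℕ; zero; suc; NonZero)
import Data.Nat as ℕ
import Data.Nat.Properties as ℕ
open import Data.Nat.DivMod using (m≡m%n+[m/n]*n; m%n<n; m<n⇒m%n≡m)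
open import Data.Fin using (Fin; toℕ; fromℕ<)
import Data.Fin as Fin
import Data.Fin.Properties as Fin
open import Data.Product using (_×_; ∃; ∃₂; _,_; proj₁; proj₂)
open import Data.Sum using (_⊎_; inj₁; inj₂; [_,_])
open import Data.Empty using (⊥-elim)
open import Function using (id; _∘_; _∘′_)
open import Function.Bundles using (_⇔_; mk⇔; Equivalence)
open import Function.Properties.Equivalence using () renaming (trans to ⇔-trans)
open import Function.Related.Propositional using (module EquationalReasoning)
open import Data.Sum.Function.Propositional using (_⊎-⇔_)
open import Relation.Nullary using (¬_; yes; no)
open import Relation.Binary.Bundles using (Setoid)
open import Relation.Binary.Definitions using (Decidable; tri<; tri≈; tri>)
open import Relation.Binary.PropositionalEquality using (_≡_; cong; cong₂)
import Relation.Binary.PropositionalEquality as ≡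
open import Algebra.Bundles using (CommutativeRing)
open import Data.Nat.Primality using (Prime; prime⇒nonTrivial)

module Arithmetic where
  open import Data.Nat using (_+_; _*_; _^_; _∸_; _<_; _≤_; _/_; _%_)
  open import Data.Nat.DivMod using (m*n/n≡m; m≥n⇒m/n>0)
  open import Data.Nat.Tactic.RingSolver using (solve-∀)

  odd⇒≡1+[n/2]*2 : ∀ n → n % 2 ≡ 1 → n ≡ suc (n / 2 * 2)
  odd⇒≡1+[n/2]*2 n n-odd = ≡.trans (m≡m%n+[m/n]*n n 2) (cong (_+ n / 2 * 2) n-odd)

  -- Data.Nat.Tactic.RingSolver does not handle _^_, so squares are expanded before solving.
  n^2≡n*n : ∀ n → n ^ 2 ≡ n * n
  n^2≡n*n n = cong (n *_) (ℕ.*-identityʳ n)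

  odd²+1≡[odd²+1]/2+[odd²+1]/2 : ∀ n → n % 2 ≡ 1 → n ^ 2 + 1 ≡ (n ^ 2 + 1) / 2 + (n ^ 2 + 1) / 2
  odd²+1≡[odd²+1]/2+[odd²+1]/2 n n-odd = begin
    n ^ 2 + 1     ≡⟨ n²+1≡2k ⟩
    k * 2         ≡⟨ twice k ⟩
    k + k         ≡⟨ cong₂ _+_ [n²+1]/2≡k [n²+1]/2≡k ⟨
    (n ^ 2 + 1) / 2 + (n ^ 2 + 1) / 2 ∎
    where
    open ≡.≡-Reasoning
    t k : ℕ
    t = n / 2
    k = 1 + 2 * t + 2 * (t * t)

    [1+2t]²+1≡[1+2t+2t²]*2 : ∀ t → (1 + t * 2) * (1 + t * 2) + 1 ≡ (1 + 2 * t + 2 * (t * t)) * 2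
    [1+2t]²+1≡[1+2t+2t²]*2 = solve-∀

    twice : ∀ m → m * 2 ≡ m + m
    twice = solve-∀

    n²+1≡2k : n ^ 2 + 1 ≡ k * 2
    n²+1≡2k = begin
      n ^ 2 + 1                   ≡⟨ cong (_+ 1) (n^2≡n*n n) ⟩
      n * n + 1                   ≡⟨ cong (λ m → m * m + 1) (odd⇒≡1+[n/2]*2 n n-odd) ⟩
      (1 + t * 2) * (1 + t * 2) + 1 ≡⟨ [1+2t]²+1≡[1+2t+2t²]*2 t ⟩
      k * 2                       ∎

    [n²+1]/2≡k : (n ^ 2 + 1) / 2 ≡ k
    [n²+1]/2≡k = ≡.trans (cong (_/ 2) n²+1≡2k) (m*n/n≡m k 2)

  0<[n²+1]/2 : ∀ n .{{_ : NonZero n}} → 0 < (n ^ 2 + 1) / 2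
  0<[n²+1]/2 n = m≥n⇒m/n>0 (ℕ.+-monoˡ-≤ 1 (ℕ.m^n>0 n 2))

  n²≡1+[n∸1]*[1+n] : ∀ {n} → 0 < n → n ^ 2 ≡ suc ((n ∸ 1) * suc n)
  n²≡1+[n∸1]*[1+n] {suc p} _ = ≡.trans (n^2≡n*n (suc p)) ([1+p]²≡1+p*[2+p] p)
    where
    [1+p]²≡1+p*[2+p] : ∀ p → (1 + p) * (1 + p) ≡ 1 + p * (2 + p)
    [1+p]²≡1+p*[2+p] = solve-∀

  n²≡1+m⇒n⁴≡1+m*[n²+1] : ∀ n {m} → n ^ 2 ≡ suc m → n ^ 4 ≡ suc (m * (n ^ 2 + 1))
  n²≡1+m⇒n⁴≡1+m*[n²+1] n {m} n²≡1+m = begin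
    n ^ 4                   ≡⟨ ℕ.^-distribˡ-+-* n 2 2 ⟩
    n ^ 2 * n ^ 2           ≡⟨ cong₂ _*_ n²≡1+m n²≡1+m ⟩
    (1 + m) * (1 + m)       ≡⟨ [1+m]²≡1+m*[[1+m]+1] m ⟩
    1 + m * ((1 + m) + 1)   ≡⟨ cong (λ e → 1 + m * (e + 1)) n²≡1+m ⟨
    1 + m * (n ^ 2 + 1)     ∎
    where
    open ≡.≡-Reasoning
    [1+m]²≡1+m*[[1+m]+1] : ∀ m → (1 + m) * (1 + m) ≡ 1 + m * ((1 + m) + 1)
    [1+m]²≡1+m*[[1+m]+1] = solve-∀

  x<n²+1⇒x*[n+1]<N : ∀ {x} n → x < n ^ 2 + 1 → x * (n + 1) < N n
  x<n²+1⇒x*[n+1]<N {x} n x<n²+1 = ℕ.s≤s (begin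
    x * (n + 1)            ≤⟨ ℕ.*-monoˡ-≤ (n + 1) x≤n² ⟩
    n ^ 2 * (n + 1)        ≡⟨ a[n+1]≡n*a+a (n ^ 2) n ⟩
    n ^ 3 + n ^ 2          ≤⟨ ℕ.m≤m+n (n ^ 3 + n ^ 2) n ⟩
    n ^ 3 + n ^ 2 + n      ∎)
    where
    open ℕ.≤-Reasoning
    x≤n² : x ≤ n ^ 2
    x≤n² = ℕ.m<1+n⇒m≤n (≡.subst (x <_) (ℕ.+-comm (n ^ 2) 1) x<n²+1)

    a[n+1]≡n*a+a : ∀ a n → a * (n + 1) ≡ n * a + a
    a[n+1]≡n*a+a = solve-∀

open Arithmetic

module _ {a ℓ : Level} (S : Setoid a ℓ) where
  open Setoid S

  ≈-resp-⇔ : ∀ {x x′ y y′} → x ≈ x′ → y ≈ y′ → (x ≈ y ⇔ x′ ≈ y′)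
  ≈-resp-⇔ x≈x′ y≈y′ = mk⇔ (λ x≈y → trans (sym x≈x′) (trans x≈y y≈y′))
                           (λ x′≈y′ → trans x≈x′ (trans x′≈y′ (sym y≈y′)))

module RingPowers {c ℓ : Level} (F : CommutativeRing c ℓ) where
  open CommutativeRing F
  open import Algebra.Properties.Ring ring using (-1*x≈-x; -‿involutive)
  open import Algebra.Properties.CommutativeSemiring.Exp commutativeSemiring public
  open import Relation.Binary.Reasoning.Setoid setoid

  pow≡^ : ∀ a n → pow F a n ≡ a ^ n
  pow≡^ a zero    = ≡.refl
  pow≡^ a (suc n) = cong (a *_) (pow≡^ a n)

  1^n≈1 : ∀ n → 1# ^ n ≈ 1#
  1^n≈1 zero    = refl
  1^n≈1 (suc n) = trans (*-identityˡ _) (1^n≈1 n)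

  [x^m]^n≈[x^n]^m : ∀ x m n → (x ^ m) ^ n ≈ (x ^ n) ^ m
  [x^m]^n≈[x^n]^m x m n =
    trans (^-assocʳ x m n) (trans (reflexive (cong (x ^_) (ℕ.*-comm m n))) (sym (^-assocʳ x n m)))

  x^d≈1⇒x^n≈x^[n%d] : ∀ {x} d .{{_ : NonZero d}} → x ^ d ≈ 1# → ∀ n → x ^ n ≈ x ^ (n ℕ.% d)
  x^d≈1⇒x^n≈x^[n%d] {x} d x^d≈1 n = begin
    x ^ n                                 ≡⟨ cong (x ^_) (m≡m%n+[m/n]*n n d) ⟩
    x ^ (n ℕ.% d ℕ.+ n ℕ./ d ℕ.* d)       ≈⟨ ^-homo-* x (n ℕ.% d) (n ℕ./ d ℕ.* d) ⟩
    x ^ (n ℕ.% d) * x ^ (n ℕ./ d ℕ.* d)   ≡⟨ cong (λ e → x ^ (n ℕ.% d) * x ^ e) (ℕ.*-comm (n ℕ./ d) d) ⟩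
    x ^ (n ℕ.% d) * x ^ (d ℕ.* (n ℕ./ d)) ≈⟨ *-congˡ (^-assocʳ x d (n ℕ./ d)) ⟨
    x ^ (n ℕ.% d) * (x ^ d) ^ (n ℕ./ d)   ≈⟨ *-congˡ (trans (^-congˡ (n ℕ./ d) x^d≈1) (1^n≈1 (n ℕ./ d))) ⟩
    x ^ (n ℕ.% d) * 1#                    ≈⟨ *-identityʳ _ ⟩
    x ^ (n ℕ.% d)                         ∎

  -1^2≈1 : (- 1#) ^ 2 ≈ 1#
  -1^2≈1 = begin
    - 1# * (- 1# * 1#) ≈⟨ -1*x≈-x _ ⟩
    - (- 1# * 1#)      ≈⟨ -‿cong (*-identityʳ _) ⟩
    - - 1#             ≈⟨ -‿involutive 1# ⟩
    1#                 ∎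

  -1^odd≈-1 : ∀ n → n ℕ.% 2 ≡ 1 → (- 1#) ^ n ≈ - 1#
  -1^odd≈-1 n n-odd = begin
    (- 1#) ^ n         ≈⟨ x^d≈1⇒x^n≈x^[n%d] 2 -1^2≈1 n ⟩
    (- 1#) ^ (n ℕ.% 2) ≡⟨ cong ((- 1#) ^_) n-odd ⟩
    - 1# * 1#          ≈⟨ *-identityʳ _ ⟩
    - 1#               ∎

  x^q≈-1⇔x≈-1 : ∀ {x} q → q ℕ.% 2 ≡ 1 → x ^ (q ℕ.^ 2 ℕ.+ 1) ≈ 1# → (x ^ q ≈ - 1# ⇔ x ≈ - 1#)
  x^q≈-1⇔x≈-1 {x} q q-odd x^[q²+1]≈1 = mk⇔ to from
    where
    from : x ≈ - 1# → x ^ q ≈ - 1#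
    from x≈-1 = trans (^-congˡ q x≈-1) (-1^odd≈-1 q q-odd)

    to : x ^ q ≈ - 1# → x ≈ - 1#
    to x^q≈-1 = begin
      x                        ≈⟨ -‿involutive x ⟨
      - - x                    ≈⟨ -‿cong (-1*x≈-x x) ⟨
      - (- 1# * x)             ≈⟨ -‿cong (*-cong x^q²≈-1 (*-identityʳ x)) ⟨
      - (x ^ (q ℕ.^ 2) * x ^ 1) ≈⟨ -‿cong (^-homo-* x (q ℕ.^ 2) 1) ⟨
      - (x ^ (q ℕ.^ 2 ℕ.+ 1))  ≈⟨ -‿cong x^[q²+1]≈1 ⟩
      - 1#                     ∎
      where
      x^q²≈-1 : x ^ (q ℕ.^ 2) ≈ - 1#
      x^q²≈-1 = begin
        x ^ (q ℕ.^ 2)  ≡⟨ cong (λ e → x ^ (q ℕ.* e)) (ℕ.*-identityʳ q) ⟩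
        x ^ (q ℕ.* q)  ≈⟨ ^-assocʳ x q q ⟨
        (x ^ q) ^ q    ≈⟨ ^-congˡ q x^q≈-1 ⟩
        (- 1#) ^ q     ≈⟨ -1^odd≈-1 q q-odd ⟩
        - 1#           ∎

module FieldProperties {c ℓ : Level} (F : CommutativeRing c ℓ) (isField : IsField F) where
  open CommutativeRing F
  open import Algebra.Properties.Ring ring
    using (-‿distribʳ-*; +-inverseˡ-unique; x∙y⁻¹≈ε⇒x≈y; [y-z]x≈yx-zx)
  open import Relation.Binary.Reasoning.Setoid setoid

  *-cancelˡ : ∀ {x y z} → ¬ x ≈ 0# → x * y ≈ x * z → y ≈ z
  *-cancelˡ {x} {y} {z} x≉0 xy≈xz with proj₂ isField x x≉0
  ... | x⁻¹ , xx⁻¹≈1 = begin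
    y              ≈⟨ x⁻¹[xw]≈w y ⟨
    x⁻¹ * (x * y)  ≈⟨ *-congˡ xy≈xz ⟩
    x⁻¹ * (x * z)  ≈⟨ x⁻¹[xw]≈w z ⟩
    z              ∎
    where
    x⁻¹[xw]≈w : ∀ w → x⁻¹ * (x * w) ≈ w
    x⁻¹[xw]≈w w = begin
      x⁻¹ * (x * w) ≈⟨ *-assoc x⁻¹ x w ⟨
      x⁻¹ * x * w   ≈⟨ *-congʳ (trans (*-comm x⁻¹ x) xx⁻¹≈1) ⟩
      1# * w        ≈⟨ *-identityˡ w ⟩
      w             ∎

  x≉0∧x*y≈0⇒y≈0 : ∀ {x y} → ¬ x ≈ 0# → x * y ≈ 0# → y ≈ 0#
  x≉0∧x*y≈0⇒y≈0 {x} x≉0 xy≈0 = *-cancelˡ x≉0 (trans xy≈0 (sym (zeroʳ x)))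

  x*y≈0⇔x≈0⊎y≈0 : Decidable _≈_ → ∀ {x y} → x * y ≈ 0# ⇔ (x ≈ 0# ⊎ y ≈ 0#)
  x*y≈0⇔x≈0⊎y≈0 _≟_ {x} {y} = mk⇔ to from
    where
    to : x * y ≈ 0# → x ≈ 0# ⊎ y ≈ 0#
    to xy≈0 with x ≟ 0#
    ... | yes x≈0 = inj₁ x≈0
    ... | no x≉0  = inj₂ (x≉0∧x*y≈0⇒y≈0 x≉0 xy≈0)

    from : x ≈ 0# ⊎ y ≈ 0# → x * y ≈ 0#
    from (inj₁ x≈0) = trans (*-congʳ x≈0) (zeroˡ y)
    from (inj₂ y≈0) = trans (*-congˡ y≈0) (zeroʳ x)

  x*-1≈-x : ∀ x → x * - 1# ≈ - x
  x*-1≈-x x = trans (sym (-‿distribʳ-* x 1#)) (-‿cong (*-identityʳ x))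

  x+x*y≈0⇔y≈-1 : ∀ {x y} → ¬ x ≈ 0# → (x + x * y ≈ 0# ⇔ y ≈ - 1#)
  x+x*y≈0⇔y≈-1 {x} {y} x≉0 = mk⇔ to from
    where
    to : x + x * y ≈ 0# → y ≈ - 1#
    to x+xy≈0 = *-cancelˡ x≉0 (begin
      x * y   ≈⟨ +-inverseˡ-unique (x * y) x (trans (+-comm (x * y) x) x+xy≈0) ⟩
      - x     ≈⟨ x*-1≈-x x ⟨
      x * - 1# ∎)

    from : y ≈ - 1# → x + x * y ≈ 0#
    from y≈-1 = begin
      x + x * y    ≈⟨ +-congˡ (trans (*-congˡ y≈-1) (x*-1≈-x x)) ⟩
      x + - x      ≈⟨ -‿inverseʳ x ⟩
      0#           ∎

  x*x≈1∧x≉1⇒x≈-1 : ∀ {x} → x * x ≈ 1# → ¬ x ≈ 1# → x ≈ - 1#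
  x*x≈1∧x≉1⇒x≈-1 {x} xx≈1 x≉1 =
    +-inverseˡ-unique x 1# (x≉0∧x*y≈0⇒y≈0 x-1≉0 [x-1][x+1]≈0)
    where
    x-1≉0 : ¬ x - 1# ≈ 0#
    x-1≉0 x-1≈0 = x≉1 (x∙y⁻¹≈ε⇒x≈y x 1# x-1≈0)

    x[x+1]≈x+1 : x * (x + 1#) ≈ x + 1#
    x[x+1]≈x+1 = begin
      x * (x + 1#)     ≈⟨ distribˡ x x 1# ⟩
      x * x + x * 1#   ≈⟨ +-cong xx≈1 (*-identityʳ x) ⟩
      1# + x           ≈⟨ +-comm 1# x ⟩
      x + 1#           ∎

    [x-1][x+1]≈0 : (x - 1#) * (x + 1#) ≈ 0#
    [x-1][x+1]≈0 = begin
      (x - 1#) * (x + 1#)            ≈⟨ [y-z]x≈yx-zx (x + 1#) x 1# ⟩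
      x * (x + 1#) - 1# * (x + 1#)   ≈⟨ +-cong x[x+1]≈x+1 (-‿cong (*-identityˡ (x + 1#))) ⟩
      (x + 1#) - (x + 1#)            ≈⟨ -‿inverseʳ (x + 1#) ⟩
      0#                             ∎

module Cardinality {c ℓ : Level} (F : CommutativeRing c ℓ) {n : ℕ} (card : HasCardinality F n) where
  open CommutativeRing F

  private
    enum : Fin n → Carrier
    enum = proj₁ card

    enum-injective : ∀ i j → enum i ≈ enum j → i ≡ j
    enum-injective = proj₁ (proj₂ card)

    index : Carrier → Fin n
    index y = proj₁ (proj₂ (proj₂ card) y)

    enum∘index≈id : ∀ y → enum (index y) ≈ y
    enum∘index≈id y = proj₂ (proj₂ (proj₂ card) y)

    index-injective : ∀ {x y} → index x ≡ index y → x ≈ y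
    index-injective {x} {y} eq =
      trans (sym (enum∘index≈id x)) (trans (reflexive (cong enum eq)) (enum∘index≈id y))

    index-cong : ∀ {x y} → x ≈ y → index x ≡ index y
    index-cong {x} {y} x≈y =
      enum-injective _ _ (trans (enum∘index≈id x) (trans x≈y (sym (enum∘index≈id y))))

  _≟_ : Decidable _≈_
  x ≟ y with index x Fin.≟ index y
  ... | yes eq = yes (index-injective eq)
  ... | no neq = no (λ x≈y → neq (index-cong x≈y))

  pigeonhole : ∀ {m} → n ℕ.< m → (f : Fin m → Carrier) → ∃₂ λ i j → i Fin.< j × f i ≈ f j
  pigeonhole n<m f with Fin.pigeonhole n<m (λ i → index (f i))
  ... | i , j , i<j , eq = i , j , i<j , index-injective eq

  surjective⇒≤ : ∀ {m} (f : Fin m → Carrier) → (∀ y → ∃ λ i → f i ≈ y) → n ℕ.≤ m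
  surjective⇒≤ {m} f surj = Fin.injective⇒≤ section-injective
    where
    section : Fin n → Fin m
    section k = proj₁ (surj (enum k))

    section-injective : ∀ {k l} → section k ≡ section l → k ≡ l
    section-injective {k} {l} eq = enum-injective k l
      (trans (sym (proj₂ (surj (enum k)))) (trans (reflexive (cong f eq)) (proj₂ (surj (enum l)))))

module PrimitiveElement {c ℓ : Level} (F : CommutativeRing c ℓ) (isField : IsField F)
  {K : ℕ} (card : HasCardinality F (suc K))
  (α : CommutativeRing.Carrier F) (α-primitive : IsPrimitive F α) where
  open CommutativeRing F
  open RingPowers F
  open FieldProperties F isField
  open Cardinality F card
  open import Relation.Binary.Reasoning.Setoid setoid

  α^n≉0 : ∀ n → ¬ α ^ n ≈ 0#
  α^n≉0 zero    = proj₁ isField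
  α^n≉0 (suc n) = α^n≉0 n ∘′ x≉0∧x*y≈0⇒y≈0 (proj₁ α-primitive)

  α^i≈α^j⇒α^[j∸i]≈1 : ∀ {i j} → i ℕ.≤ j → α ^ i ≈ α ^ j → α ^ (j ℕ.∸ i) ≈ 1#
  α^i≈α^j⇒α^[j∸i]≈1 {i} {j} i≤j α^i≈α^j = *-cancelˡ (α^n≉0 i) (begin
    α ^ i * α ^ (j ℕ.∸ i)  ≈⟨ ^-homo-* α i (j ℕ.∸ i) ⟨
    α ^ (i ℕ.+ (j ℕ.∸ i))  ≡⟨ cong (α ^_) (ℕ.m+[n∸m]≡n i≤j) ⟩
    α ^ j                  ≈⟨ α^i≈α^j ⟨
    α ^ i                  ≈⟨ *-identityʳ (α ^ i) ⟨
    α ^ i * 1#             ∎)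

  zeroOrPower : ∀ {m} → Fin (suc m) → Carrier
  zeroOrPower Fin.zero    = 0#
  zeroOrPower (Fin.suc i) = α ^ toℕ i

  α^d≈1⇒K≤d : ∀ d → 0 ℕ.< d → α ^ d ≈ 1# → K ℕ.≤ d
  α^d≈1⇒K≤d d 0<d α^d≈1 = ℕ.≤-pred (surjective⇒≤ zeroOrPower zeroOrPower-surjective)
    where
    instance
      d≢0 : NonZero d
      d≢0 = ℕ.>-nonZero 0<d

    zeroOrPower-surjective : ∀ y → ∃ λ i → zeroOrPower {d} i ≈ y
    zeroOrPower-surjective y with y ≟ 0#
    ... | yes y≈0 = Fin.zero , sym y≈0
    ... | no y≉0 with proj₂ α-primitive y y≉0
    ...   | k , α^k≈y = Fin.suc (fromℕ< (m%n<n k d)) , (begin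
      α ^ toℕ (fromℕ< (m%n<n k d)) ≡⟨ cong (α ^_) (Fin.toℕ-fromℕ< (m%n<n k d)) ⟩
      α ^ (k ℕ.% d)                ≈⟨ x^d≈1⇒x^n≈x^[n%d] d α^d≈1 k ⟨
      α ^ k                        ≡⟨ pow≡^ α k ⟨
      pow F α k                    ≈⟨ α^k≈y ⟩
      y                            ∎)

  α^K≈1 : α ^ K ≈ 1#
  α^K≈1 with pigeonhole (ℕ.n<1+n (suc K)) (zeroOrPower {suc K})
  ... | Fin.zero  , Fin.suc j , _   , 0≈α^j   = ⊥-elim (α^n≉0 (toℕ j) (sym 0≈α^j))
  ... | Fin.suc i , Fin.suc j , i<j , α^i≈α^j = begin
    α ^ K                  ≡⟨ cong (α ^_) d≡K ⟨
    α ^ (toℕ j ℕ.∸ toℕ i)  ≈⟨ α^d≈1 ⟩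
    1#                     ∎
    where
    α^d≈1 : α ^ (toℕ j ℕ.∸ toℕ i) ≈ 1#
    α^d≈1 = α^i≈α^j⇒α^[j∸i]≈1 (ℕ.<⇒≤ (ℕ.s<s⁻¹ i<j)) α^i≈α^j

    d≡K : toℕ j ℕ.∸ toℕ i ≡ K
    d≡K = ℕ.≤-antisym (ℕ.≤-trans (ℕ.m∸n≤m (toℕ j) (toℕ i)) (Fin.toℕ≤pred[n] j))
      (α^d≈1⇒K≤d _ (ℕ.m<n⇒0<n∸m (ℕ.s<s⁻¹ i<j)) α^d≈1)

  α^i≉α^j : ∀ {i j} → i ℕ.< j → j ℕ.< K → ¬ α ^ i ≈ α ^ j
  α^i≉α^j {i} {j} i<j j<K α^i≈α^j = ℕ.<⇒≱ (ℕ.≤-<-trans (ℕ.m∸n≤m j i) j<K)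
    (α^d≈1⇒K≤d (j ℕ.∸ i) (ℕ.m<n⇒0<n∸m i<j) (α^i≈α^j⇒α^[j∸i]≈1 (ℕ.<⇒≤ i<j) α^i≈α^j))

  α^-injective : ∀ {i j} → i ℕ.< K → j ℕ.< K → α ^ i ≈ α ^ j → i ≡ j
  α^-injective {i} {j} i<K j<K α^i≈α^j with ℕ.<-cmp i j
  ... | tri< i<j _ _ = ⊥-elim (α^i≉α^j i<j j<K α^i≈α^j)
  ... | tri≈ _ i≡j _ = i≡j
  ... | tri> _ _ j<i = ⊥-elim (α^i≉α^j j<i i<K (sym α^i≈α^j))

  [α^n]^K≈1 : ∀ n → (α ^ n) ^ K ≈ 1#
  [α^n]^K≈1 n = begin
    (α ^ n) ^ K    ≈⟨ [x^m]^n≈[x^n]^m α n K ⟩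
    (α ^ K) ^ n    ≈⟨ ^-congˡ n α^K≈1 ⟩
    1# ^ n         ≈⟨ 1^n≈1 n ⟩
    1#             ∎

  α^[K/2]≈-1 : ∀ {m} → K ≡ m ℕ.+ m → 0 ℕ.< m → α ^ m ≈ - 1#
  α^[K/2]≈-1 {m} K≡m+m 0<m = x*x≈1∧x≉1⇒x≈-1 α^m*α^m≈1 α^m≉1
    where
    α^m*α^m≈1 : α ^ m * α ^ m ≈ 1#
    α^m*α^m≈1 = trans (sym (^-homo-* α m m)) (trans (reflexive (cong (α ^_) (≡.sym K≡m+m))) α^K≈1)

    α^m≉1 : ¬ α ^ m ≈ 1#
    α^m≉1 α^m≈1 = ℕ.<⇒≱ (≡.subst (m ℕ.<_) (≡.sym K≡m+m) (ℕ.m<m+n m 0<m)) (α^d≈1⇒K≤d m 0<m α^m≈1)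

module CyclicSum {c ℓ : Level} (F : CommutativeRing c ℓ) where
  open import Tactic.RingSolver using (solve-∀)
  open import Tactic.RingSolver.Core.AlmostCommutativeRing using (AlmostCommutativeRing; fromCommutativeRing)
  open import Data.Maybe using (nothing)

  private
    F′ : AlmostCommutativeRing c ℓ
    F′ = fromCommutativeRing F (λ _ → nothing)

  -- solve-∀ only recognises the operations of the ring it is handed, so the identity is stated over F′.
  open AlmostCommutativeRing F′

  cyclic-sum-factor : ∀ x a₁ a₂ a₃ → x * a₁ + a₁ * a₂ + a₂ * a₃ + a₃ * x ≈ (x + a₂) * (a₁ + a₃)
  cyclic-sum-factor = solve-∀ F′

module Trace {c ℓ : Level} (F : CommutativeRing c ℓ) where
  open CommutativeRing F
  open RingPowers F
  open CyclicSum F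
  open import Relation.Binary.Reasoning.Setoid setoid

  Tr≡ : ∀ q a → Tr F q a ≡ a + a ^ q + a ^ (q ℕ.^ 2) + a ^ (q ℕ.^ 3)
  Tr≡ q a rewrite pow≡^ a q | pow≡^ a (q ℕ.^ 2) | pow≡^ a (q ℕ.^ 3) = ≡.refl

  Tr-cong : ∀ q {a b} → a ≈ b → Tr F q a ≈ Tr F q b
  Tr-cong q {a} {b} a≈b rewrite Tr≡ q a | Tr≡ q b =
    +-cong (+-cong (+-cong a≈b (^-congˡ q a≈b)) (^-congˡ (q ℕ.^ 2) a≈b)) (^-congˡ (q ℕ.^ 3) a≈b)

  [x^[1+q]]^n≈x^n*x^[q*n] : ∀ x q n → (x ^ suc q) ^ n ≈ x ^ n * x ^ (q ℕ.* n)
  [x^[1+q]]^n≈x^n*x^[q*n] x q n = trans (^-distrib-* x (x ^ q) n) (*-congˡ (^-assocʳ x q n))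

  Tr[x^[1+q]]≈[x+x^q²][x^q+x^q³] : ∀ q {x} → x ^ (q ℕ.^ 4) ≈ x →
    Tr F q (x ^ suc q) ≈ (x + x ^ (q ℕ.^ 2)) * (x ^ q + x ^ (q ℕ.^ 3))
  Tr[x^[1+q]]≈[x+x^q²][x^q+x^q³] q {x} x^q⁴≈x = begin
    Tr F q (x ^ suc q)
      ≡⟨ Tr≡ q (x ^ suc q) ⟩
    x ^ suc q + (x ^ suc q) ^ q + (x ^ suc q) ^ (q ℕ.^ 2) + (x ^ suc q) ^ (q ℕ.^ 3)
      ≈⟨ +-cong (+-cong (+-congˡ (trans ([x^[1+q]]^n≈x^n*x^[q*n] x q q) (*-congˡ x^[q*q]≈x^q²)))
                        ([x^[1+q]]^n≈x^n*x^[q*n] x q (q ℕ.^ 2)))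
                (trans ([x^[1+q]]^n≈x^n*x^[q*n] x q (q ℕ.^ 3)) (*-congˡ x^q⁴≈x)) ⟩
    x * a₁ + a₁ * a₂ + a₂ * a₃ + a₃ * x
      ≈⟨ cyclic-sum-factor x a₁ a₂ a₃ ⟩
    (x + a₂) * (a₁ + a₃) ∎
    where
    a₁ a₂ a₃ : Carrier
    a₁ = x ^ q
    a₂ = x ^ (q ℕ.^ 2)
    a₃ = x ^ (q ℕ.^ 3)

    x^[q*q]≈x^q² : x ^ (q ℕ.* q) ≈ x ^ (q ℕ.^ 2)
    x^[q*q]≈x^q² = reflexive (cong (λ e → x ^ (q ℕ.* e)) (≡.sym (ℕ.*-identityʳ q)))

module TraceZeros {c ℓ : Level} (F : CommutativeRing c ℓ) (isField : IsField F)
  (q : ℕ) (q-odd : q ℕ.% 2 ≡ 1) (1<q : 1 ℕ.< q) (card : HasCardinality F (q ℕ.^ 4))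
  (α : CommutativeRing.Carrier F) (α-primitive : IsPrimitive F α) where
  open CommutativeRing F
  open RingPowers F
  open FieldProperties F isField
  open Trace F

  M h K : ℕ
  M = (q ℕ.∸ 1) ℕ.* suc q
  h = (q ℕ.^ 2 ℕ.+ 1) ℕ./ 2
  K = M ℕ.* (q ℕ.^ 2 ℕ.+ 1)

  instance
    q≢0 : NonZero q
    q≢0 = ℕ.>-nonZero (ℕ.<-trans ℕ.z<s 1<q)

    M≢0 : NonZero M
    M≢0 = ℕ.m*n≢0 (q ℕ.∸ 1) (suc q) {{ℕ.>-nonZero (ℕ.m<n⇒0<n∸m 1<q)}}

    h≢0 : NonZero h
    h≢0 = ℕ.>-nonZero (0<[n²+1]/2 q)

  q²≡1+M : q ℕ.^ 2 ≡ suc M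
  q²≡1+M = n²≡1+[n∸1]*[1+n] (ℕ.>-nonZero⁻¹ q)

  K≡Mh+Mh : K ≡ M ℕ.* h ℕ.+ M ℕ.* h
  K≡Mh+Mh = ≡.trans (cong (M ℕ.*_) (odd²+1≡[odd²+1]/2+[odd²+1]/2 q q-odd)) (ℕ.*-distribˡ-+ M h h)

  0<Mh : 0 ℕ.< M ℕ.* h
  0<Mh = ℕ.>-nonZero⁻¹ (M ℕ.* h) {{ℕ.m*n≢0 M h}}

  q⁴≡1+K : q ℕ.^ 4 ≡ suc K
  q⁴≡1+K = n²≡1+m⇒n⁴≡1+m*[n²+1] q q²≡1+M

  card′ : HasCardinality F (suc K)
  card′ = ≡.subst (HasCardinality F) q⁴≡1+K card

  open Cardinality F card′ using (_≟_)
  open PrimitiveElement F isField card′ α α-primitive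

  y^q²≈y*y^M : ∀ y → y ^ (q ℕ.^ 2) ≈ y * y ^ M
  y^q²≈y*y^M y = reflexive (cong (y ^_) q²≡1+M)

  α^[Mh]≈-1 : α ^ (M ℕ.* h) ≈ - 1#
  α^[Mh]≈-1 = α^[K/2]≈-1 K≡Mh+Mh 0<Mh

  Mh<K : M ℕ.* h ℕ.< K
  Mh<K = ≡.subst (M ℕ.* h ℕ.<_) (≡.sym K≡Mh+Mh) (ℕ.m<m+n (M ℕ.* h) 0<Mh)

  Tr-α^[[q+1]x]≈0⇔x≡h : ∀ x → x ℕ.< q ℕ.^ 2 ℕ.+ 1 →
    (Tr F q (pow F α ((q ℕ.+ 1) ℕ.* x)) ≈ 0#) ⇔ (x ≡ h)
  Tr-α^[[q+1]x]≈0⇔x≡h x x<q²+1 = begin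
    Tr F q (pow F α ((q ℕ.+ 1) ℕ.* x)) ≈ 0#
      ∼⟨ ≈-resp-⇔ setoid Tr≈product refl ⟩
    (z + z ^ (q ℕ.^ 2)) * (z ^ q + z ^ (q ℕ.^ 3)) ≈ 0#
      ∼⟨ x*y≈0⇔x≈0⊎y≈0 _≟_ ⟩
    ((z + z ^ (q ℕ.^ 2) ≈ 0#) ⊎ (z ^ q + z ^ (q ℕ.^ 3) ≈ 0#))
      ∼⟨ first-factor ⊎-⇔ second-factor ⟩
    ((w ≈ - 1#) ⊎ (w ^ q ≈ - 1#))
      ∼⟨ mk⇔ [ id , Equivalence.to (x^q≈-1⇔x≈-1 q q-odd w^[q²+1]≈1) ] inj₁ ⟩
    w ≈ - 1#
      ∼⟨ ≈-resp-⇔ setoid w≈α^[Mx] (sym α^[Mh]≈-1) ⟩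
    α ^ (M ℕ.* x) ≈ α ^ (M ℕ.* h)
      ∼⟨ mk⇔ (α^-injective (ℕ.*-monoʳ-< M x<q²+1) Mh<K) (reflexive ∘ cong (α ^_)) ⟩
    M ℕ.* x ≡ M ℕ.* h
      ∼⟨ mk⇔ (ℕ.*-cancelˡ-≡ x h M) (cong (M ℕ.*_)) ⟩
    x ≡ h ∎
    where
    open EquationalReasoning
    z w : Carrier
    z = α ^ x
    w = z ^ M

    z^q≉0 : ¬ z ^ q ≈ 0#
    z^q≉0 z^q≈0 = α^n≉0 (x ℕ.* q) (trans (sym (^-assocʳ α x q)) z^q≈0)

    z^q⁴≈z : z ^ (q ℕ.^ 4) ≈ z
    z^q⁴≈z = trans (reflexive (cong (z ^_) q⁴≡1+K))
                   (trans (*-congˡ ([α^n]^K≈1 x)) (*-identityʳ z))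

    Tr≈product : Tr F q (pow F α ((q ℕ.+ 1) ℕ.* x)) ≈ (z + z ^ (q ℕ.^ 2)) * (z ^ q + z ^ (q ℕ.^ 3))
    Tr≈product = trans (Tr-cong q α^[[q+1]x]≈z^[1+q]) (Tr[x^[1+q]]≈[x+x^q²][x^q+x^q³] q z^q⁴≈z)
      where
      α^[[q+1]x]≈z^[1+q] : pow F α ((q ℕ.+ 1) ℕ.* x) ≈ z ^ suc q
      α^[[q+1]x]≈z^[1+q] = trans (reflexive (≡.trans (pow≡^ α ((q ℕ.+ 1) ℕ.* x))
          (cong (α ^_) (≡.trans (cong (ℕ._* x) (ℕ.+-comm q 1)) (ℕ.*-comm (suc q) x)))))
        (sym (^-assocʳ α x (suc q)))

    z^q³≈z^q*w^q : z ^ (q ℕ.^ 3) ≈ z ^ q * w ^ q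
    z^q³≈z^q*w^q = trans (sym (^-assocʳ z q (q ℕ.^ 2)))
      (trans (y^q²≈y*y^M (z ^ q)) (*-congˡ ([x^m]^n≈[x^n]^m z q M)))

    first-factor : (z + z ^ (q ℕ.^ 2) ≈ 0#) ⇔ (w ≈ - 1#)
    first-factor = ⇔-trans (≈-resp-⇔ setoid (+-congˡ (y^q²≈y*y^M z)) refl) (x+x*y≈0⇔y≈-1 (α^n≉0 x))

    second-factor : (z ^ q + z ^ (q ℕ.^ 3) ≈ 0#) ⇔ (w ^ q ≈ - 1#)
    second-factor = ⇔-trans (≈-resp-⇔ setoid (+-congˡ z^q³≈z^q*w^q) refl) (x+x*y≈0⇔y≈-1 z^q≉0)

    w^[q²+1]≈1 : w ^ (q ℕ.^ 2 ℕ.+ 1) ≈ 1#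
    w^[q²+1]≈1 = trans (^-assocʳ z M (q ℕ.^ 2 ℕ.+ 1)) ([α^n]^K≈1 x)

    w≈α^[Mx] : w ≈ α ^ (M ℕ.* x)
    w≈α^[Mx] = trans (^-assocʳ α x M) (reflexive (cong (α ^_) (ℕ.*-comm x M)))

  InD-x[q+1]⇔x≡h : ∀ x → x ℕ.< q ℕ.^ 2 ℕ.+ 1 → InD F q α (x ℕ.* (q ℕ.+ 1)) ⇔ (x ≡ h)
  InD-x[q+1]⇔x≡h x x<q²+1 = ≡.subst (λ e → (Tr F q (pow F α e) ≈ 0#) ⇔ (x ≡ h))
    (≡.sym (≡.trans (m<n⇒m%n≡m (x<n²+1⇒x*[n+1]<N q x<q²+1)) (ℕ.*-comm x (q ℕ.+ 1))))
    (Tr-α^[[q+1]x]≈0⇔x≡h x x<q²+1)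

-- Opened only now, since the ring modules above use _+_, _*_ and _^_ for the ring operations.
open import Data.Nat using (_+_; _*_; _^_; _<_; _≤_; _/_)

1<p^k : ∀ {p k} → Prime p → 1 ≤ k → 1 < p ^ k
1<p^k {p} p-prime 1≤k = ℕ.^-monoʳ-< p (ℕ.nonTrivial⇒n>1 p {{prime⇒nonTrivial p-prime}}) 1≤k

mainTheorem11 : {c ℓ : Level} (q : ℕ) → IsOddPrimePower q →
  (F : CommutativeRing c ℓ) → IsField F → HasCardinality F (q ^ 4) →
  (α : CommutativeRing.Carrier F) → IsPrimitive F α →
  (∀ x → x < q ^ 2 + 1 →
    CommutativeRing._≈_ F (Tr F q (pow F α ((q + 1) * x))) (CommutativeRing.0# F)
      ⇔ (x ≡ (q ^ 2 + 1) / 2))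
  × (∀ x → x < q ^ 2 + 1 → InD F q α (x * (q + 1)) ⇔ (x ≡ (q ^ 2 + 1) / 2))
mainTheorem11 q ((p , k , p-prime , 1≤k , q≡p^k) , q-odd) F isField card α α-primitive =
  Tr-α^[[q+1]x]≈0⇔x≡h , InD-x[q+1]⇔x≡h
  where
  1<q : 1 < q
  1<q = ≡.subst (1 <_) (≡.sym q≡p^k) (1<p^k p-prime 1≤k)
  open TraceZeros F isField q q-odd 1<q card α α-primitive
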